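{- Let $\mathbb{P},\mathbb{Q}$ be nonempty sets and $R$ a partial order on $\mathbb{P}\times\mathbb{Q}$ such that $(\mathbb{P}\times\mathbb{Q},R)$ is based and has the projection property and the refinement property, and let $1_{\mathbb{P}}$ be the maximal element of $(\mathbb{P},b(R))$. Then the identity map is a projection from the product order $(\mathbb{P},b(R))\times(\mathbb{Q},s(R,1_{\mathbb{P}}))$ onto $(\mathbb{P}\times\mathbb{Q},R)$.
   Context: For a partial order $R$ on $\mathbb{P}\times\mathbb{Q}$: the base ordering $b(R)$ on $\mathbb{P}$ is $p\,b(R)\,p'$ iff $(p,q_0)R(p',q_1)$ for some $q_0,q_1\in\mathbb{Q}$; for $p\in\mathbb{P}$, the section ordering $s(R,p)$ on $\mathbb{Q}$ is $q\,s(R,p)\,q'$ iff $(p,q)R(p,q')$. Based: whenever $(p,q_0)R(p',q_1)$ for some $q_0,q_1$, then $(p,q)R(p',q)$ for all $q$. Projection property: whenever $(p',q')R(p,q)$ there is $q''$ with $(p,q'')R(p,q)$ and $(p',q'')R(p',q')R(p',q'')$. Refinement property: whenever $(p,q')R(p,q)$ and $p'\,b(R)\,p$, also $(p',q')R(p',q)$. A projection $\pi:\mathbb{A}\to\mathbb{B}$ between forcing orders satisfies $\pi(1_{\mathbb{A}})=1_{\mathbb{B}}$, is order preserving, and whenever $b\le\pi(a)$ there is $a'\le a$ with $\pi(a')\le b$. -}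

module Defs where

open import Level using (Level; _⊔_)
open import Data.Product using (Σ; ∃; _×_; _,_; proj₁; proj₂)
open import Relation.Binary.Core using (Rel)

-- Forcing convention: r R s means "r is stronger than (below) s"; 1 is the greatest element.

module _ {a b ℓ : Level} {P : Set a} {Q : Set b} (R : Rel (P × Q) ℓ) where

  BaseOrd : Rel P (b ⊔ ℓ)
  BaseOrd p p' = Σ Q λ q₀ → Σ Q λ q₁ → R (p , q₀) (p' , q₁)

  SectionOrd : P → Rel Q ℓ
  SectionOrd p q q' = R (p , q) (p , q')

  Based : Set (a ⊔ b ⊔ ℓ)
  Based = ∀ p p' q₀ q₁ → R (p , q₀) (p' , q₁) → ∀ q → R (p , q) (p' , q)

  ProjectionProperty : Set (a ⊔ b ⊔ ℓ)
  ProjectionProperty = ∀ p q p' q' → R (p' , q') (p , q) →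
    Σ Q λ q'' → R (p , q'') (p , q) × R (p' , q'') (p' , q') × R (p' , q') (p' , q'')

  RefinementProperty : Set (a ⊔ b ⊔ ℓ)
  RefinementProperty = ∀ p p' q q' → R (p , q') (p , q) → BaseOrd p' p → R (p' , q') (p' , q)

ProductOrd : {a b ℓ₁ ℓ₂ : Level} {A : Set a} {B : Set b} →
             Rel A ℓ₁ → Rel B ℓ₂ → Rel (A × B) (ℓ₁ ⊔ ℓ₂)
ProductOrd _≤₁_ _≤₂_ (x , y) (x' , y') = (x ≤₁ x') × (y ≤₂ y')

IsTop : {a ℓ : Level} {A : Set a} → Rel A ℓ → A → Set (a ⊔ ℓ)
IsTop _≤_ t = ∀ x → x ≤ t

-- projection π : (A, ≤A) → (B, ≤B) between forcing orders:
-- π(1_A) = 1_B (rendered: π maps the greatest element of A to a greatest element of B),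
-- order preserving, and whenever b ≤ π(a) there is a' ≤ a with π(a') ≤ b.
record IsProjection {a b ℓ₁ ℓ₂ : Level} {A : Set a} {B : Set b}
                    (_≤A_ : Rel A ℓ₁) (_≤B_ : Rel B ℓ₂) (π : A → B) : Set (a ⊔ b ⊔ ℓ₁ ⊔ ℓ₂) where
  field
    top-pres   : ∀ t → IsTop _≤A_ t → IsTop _≤B_ (π t)
    monotone   : ∀ x y → x ≤A y → π x ≤B π y
    projecting : ∀ x y → y ≤B π x → Σ A λ x' → (x' ≤A x) × (π x' ≤B y)

-- Since R is based and 1 is the top of b(R), every (p , q) lies R-below (1 , q).
-- So a step in b(R) and a step in s(R,1) are both R-steps (the latter transported
-- from 1 down to p by refinement), which gives monotonicity and preservation of 1.
-- For the projection condition, a condition below (p , q) is also below (1 , q),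
-- and the projection property at 1 yields the refining condition.
module Submission where

open import Defs
open import Level using (Level; _⊔_)
open import Data.Product using (_×_; _,_; Σ)
open import Relation.Binary.Core using (Rel)
open import Relation.Binary.Definitions using (Transitive)
open import Relation.Binary.Structures using (IsPartialOrder)
open import Relation.Binary.PropositionalEquality using (_≡_)
open import Function using (id)

module _ {a b ℓ : Level} {P : Set a} {Q : Set b} {R : Rel (P × Q) ℓ} (based : Based R) where

  BaseOrd⇒R : ∀ {p p'} → BaseOrd R p p' → ∀ q → R (p , q) (p' , q)
  BaseOrd⇒R {p} {p'} (q₀ , q₁ , r) = based p p' q₀ q₁ r

  module _ (trans : Transitive R) {1P : P} (top : IsTop (BaseOrd R) 1P) where

    private
      _≤×_ : Rel (P × Q) (b ⊔ ℓ)
      _≤×_ = ProductOrd (BaseOrd R) (SectionOrd R 1P)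

    R-below-top : ∀ p q → R (p , q) (1P , q)
    R-below-top p = BaseOrd⇒R (top p)

    ProductOrd-top⇒R-top : ∀ t → IsTop _≤×_ t → IsTop R t
    ProductOrd-top⇒R-top (t₁ , t₂) t-top (p , q) =
      let (1≤t₁ , q≤t₂) = t-top (1P , q)
      in trans (R-below-top p q) (trans q≤t₂ (BaseOrd⇒R 1≤t₁ t₂))

    ProductOrd⇒R : RefinementProperty R → ∀ x y → x ≤× y → R x y
    ProductOrd⇒R refine (p , q) (p' , q') (p≤p' , q≤q') =
      trans (refine 1P p q' q q≤q' (top p)) (BaseOrd⇒R p≤p' q')

    R-refined-by-ProductOrd : ProjectionProperty R →
      ∀ x y → R y x → Σ (P × Q) λ z → z ≤× x × R z y
    R-refined-by-ProductOrd project (p , q) (p' , q') y≤x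
      with project 1P q p' q' (trans y≤x (R-below-top p q))
    ... | q'' , q''≤q , z≤y , _ = (p' , q'') , ((q' , q , y≤x) , q''≤q) , z≤y

lemma3p7 : {a b ℓ : Level} {P : Set a} {Q : Set b} → P → Q →
    (R : Rel (P × Q) ℓ) → IsPartialOrder _≡_ R →
    Based R → ProjectionProperty R → RefinementProperty R →
    (1P : P) → IsTop (BaseOrd R) 1P →
    IsProjection (ProductOrd (BaseOrd R) (SectionOrd R 1P)) R id
lemma3p7 _ _ R po based project refine 1P top = record
  { top-pres   = ProductOrd-top⇒R-top based trans top
  ; monotone   = ProductOrd⇒R based trans top refine
  ; projecting = R-refined-by-ProductOrd based trans top project
  }
  where trans = IsPartialOrder.trans po
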